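{- Let $H$ be a graph and $W\subseteq V(H)$ a set of size $t$. Then there is some $D\in\mathbb N$ such that $q:=D\cdot\varepsilon(H,W)$ is an integer and $H$ contains a $D$-congested $K_{t,q}$-linkage, where $V(K_{t,q})=W$.
   Context: For $u,v\in V(H)$, $\mathcal P_H(u,v)$ is the set of paths from $u$ to $v$ in $H$ (for $u=v$ only the one-vertex path $(u)$). $\varepsilon(H,W)$ is the optimal value of the LP: maximize $\varepsilon$ subject to $\sum_{p\in\mathcal P_H(u,v)}x_p\ge\varepsilon$ for all $u,v\in W$; $\sum_{u,v\in W}\sum_{p\in\mathcal P_H(u,v),\,w\in p}x_p\le1$ for all $w\in V(H)$; $x_p\ge0$. $K_{t,q}$ denotes the multigraph on $t$ vertices in which every pair of distinct vertices is joined by exactly $q$ parallel edges. For a multigraph $M$ with $V(M)\subseteq V(H)$, an $M$-linkage in $H$ is a family $(P_e)_{e\in E(M)}$ of paths in $H$ with $P_e$ having the endpoints of $e$ as endpoints; it is $D$-congested if every vertex of $H$ lies on at most $D$ of the paths. -}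

module Defs where

open import Data.Bool using (Bool; true; false; _∧_; not; if_then_else_)
open import Data.Nat as ℕ using (ℕ; zero; suc)
open import Data.Fin using (Fin; _≟_; _<_)
open import Data.List using (List; []; _∷_; map; concatMap; allFin; upTo; filter; foldr)
open import Data.Integer using (+_)
open import Data.Rational as ℚ using (ℚ; 0ℚ; 1ℚ; _≤_)
open import Data.Product using (Σ; _×_; ∃)
open import Relation.Nullary.Decidable using (⌊_⌋)
open import Relation.Binary.PropositionalEquality using (_≡_; _≢_)

record Graph : Set where
  field
    n      : ℕ
    adj    : Fin n → Fin n → Bool
    adj-sym     : ∀ i j → adj i j ≡ adj j i
    adj-irrefl  : ∀ i → adj i i ≡ false

open Graph public

module _ (H : Graph) where
  V : Set
  V = Fin (n H)

  memB : V → List V → Bool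
  memB w []      = false
  memB w (x ∷ r) = if ⌊ x ≟ w ⌋ then true else memB w r

  adjChainB : List V → Bool
  adjChainB []            = true
  adjChainB (x ∷ [])      = true
  adjChainB (x ∷ y ∷ r)   = adj H x y ∧ adjChainB (y ∷ r)

  distinctB : List V → Bool
  distinctB []      = true
  distinctB (x ∷ r) = not (memB x r) ∧ distinctB r

  headIsB : V → List V → Bool
  headIsB u []      = false
  headIsB u (x ∷ _) = ⌊ x ≟ u ⌋

  lastIsB : V → List V → Bool
  lastIsB v []          = false
  lastIsB v (x ∷ [])    = ⌊ x ≟ v ⌋
  lastIsB v (x ∷ y ∷ r) = lastIsB v (y ∷ r)

  isPathB : V → V → List V → Bool
  isPathB u v p = headIsB u p ∧ lastIsB v p ∧ adjChainB p ∧ distinctB p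

  IsPath : V → V → List V → Set
  IsPath u v p = isPathB u v p ≡ true

  listsOfLen : ℕ → List (List V)
  listsOfLen zero    = [] ∷ []
  listsOfLen (suc k) = concatMap (λ l → map (_∷ l) (allFin (n H))) (listsOfLen k)

  allLists : List (List V)
  allLists = concatMap listsOfLen (upTo (suc (n H)))

  -- P_H(u,v): enumeration (without repetition) of all paths from u to v
  paths : V → V → List (List V)
  paths u v = filter (λ p → isPathB u v p Data.Bool.≟ true) allLists

sumℚ : List ℚ → ℚ
sumℚ = foldr ℚ._+_ 0ℚ

sumℕ : List ℕ → ℕ
sumℕ = foldr ℕ._+_ 0

Σℚ : (t : ℕ) → (Fin t → ℚ) → ℚ
Σℚ t f = sumℚ (map f (allFin t))

Σℕ : (t : ℕ) → (Fin t → ℕ) → ℕ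
Σℕ t f = sumℕ (map f (allFin t))

module _ (H : Graph) {t : ℕ} (W : Fin t → Fin (n H)) where
  -- W is given as an injective map Fin t → V(H); its image is the set W,
  -- so sums over u,v ∈ W are sums over i,j : Fin t.

  -- Feasibility of (x, ε) for the LP defining ε(H,W).  The variable x_p is
  -- the value x p for p a path; values on non-paths play no role.
  Feasible : (List (V H) → ℚ) → ℚ → Set
  Feasible x ε =
      (∀ p → 0ℚ ≤ x p)
    × (∀ i j → ε ≤ sumℚ (map x (paths H (W i) (W j))))
    × (∀ (w : V H) →
         Σℚ t (λ i → Σℚ t (λ j →
           sumℚ (map x (filter (λ p → memB H w p Data.Bool.≟ true)
                               (paths H (W i) (W j)))))) ≤ 1ℚ)

  IsEps : ℚ → Set
  IsEps ε = (∃ λ x → Feasible x ε) × (∀ x ε' → Feasible x ε' → ε' ≤ ε)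

  -- A K_{t,q}-linkage on vertex set W: for each pair i < j and each of the
  -- q parallel edges k, a path P i j k in H from W i to W j
  -- (entries with ¬ i < j are ignored).
  IsLinkage : (q : ℕ) → (Fin t → Fin t → Fin q → List (V H)) → Set
  IsLinkage q P = ∀ i j → i < j → ∀ k → IsPath H (W i) (W j) (P i j k)

  load : (q : ℕ) → (Fin t → Fin t → Fin q → List (V H)) → V H → ℕ
  load q P w = Σℕ t (λ i → Σℕ t (λ j →
                 if ⌊ Data.Fin._<?_ i j ⌋
                 then Σℕ q (λ k → if memB H w (P i j k) then 1 else 0)
                 else 0))

  Congested : (D q : ℕ) → (Fin t → Fin t → Fin q → List (V H)) → Set
  Congested D q P = ∀ w → load q P w ℕ.≤ D

-- Fix an optimal solution (x, ε); ε ≥ 0 because x = 0 is feasible.  Its entries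
-- are nonnegative rationals, so for a common denominator D of ε and all the x_p
-- the numbers D·x_p and q = D·ε are natural.  Taking every path p between W i
-- and W j exactly D·x_p times gives at least D·ε = q paths for each pair, and by
-- the vertex constraint of the LP at most D·Σ_{p ∋ w} x_p ≤ D of all these paths
-- pass through a vertex w.
module Submission where

open import Defs
open import Data.Nat using (ℕ; _≥_)
open import Data.Fin using (Fin)
open import Data.List using (List)
open import Data.Integer using (+_)
open import Data.Rational using (ℚ; _/_; _*_)
open import Data.Product using (Σ; _×_; ∃)
open import Function.Definitions using (Injective)
open import Relation.Binary.PropositionalEquality using (_≡_)

open import Data.Bool as Bool using (Bool; true; false; if_then_else_)
open import Data.Fin as Fin using (inject≤)
open import Data.Integer as ℤ using (-[1+_])
import Data.Integer.Properties as ℤ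
open import Data.List
  using ([]; _∷_; _++_; map; replicate; concatMap; filter; length; lookup; tabulate; allFin)
import Data.List.Properties as List
open import Data.List.Membership.Propositional using (_∈_)
open import Data.List.Membership.Propositional.Properties using (∈-map⁺; ∈-lookup)
open import Data.List.Relation.Unary.All as All using (All)
import Data.List.Relation.Unary.All.Properties as All
open import Data.List.Relation.Unary.Any using (here; there)
import Data.Nat as ℕ
open import Data.Nat using (zero; suc)
import Data.Nat.Properties as ℕ
open import Data.Nat.Divisibility using (_∣_)
open import Data.Nat.DivMod using (m/n*n≡m)
open import Data.Nat.ListAction using (product)
open import Data.Nat.ListAction.Properties using (sum-++; ∈⇒∣product; product≢0)
open import Data.Product using (_,_; proj₁; proj₂)
open import Data.Rational as ℚ using (mkℚ; 0ℚ; 1ℚ; _≤_; ↥_; ↧ₙ_; toℚᵘ)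
import Data.Rational.Properties as ℚ
open import Data.Rational.Unnormalised as ℚᵘ using (mkℚᵘ; _≃_; *≡*; *≤*)
import Data.Rational.Unnormalised.Properties as ℚᵘ
open import Function using (_∘_; id)
open import Relation.Binary.PropositionalEquality
  using (refl; sym; trans; cong; cong₂; subst₂; module ≡-Reasoning)
open import Relation.Nullary.Decidable using (⌊_⌋)

toℚ : ℕ → ℚ
toℚ n = + n / 1

-- + n / 1 is definitionally fromℚᵘ (mkℚᵘ (+ n) 0).
toℚᵘ-toℚ : ∀ n → toℚᵘ (toℚ n) ≃ mkℚᵘ (+ n) 0
toℚᵘ-toℚ n = ℚ.toℚᵘ-fromℚᵘ (mkℚᵘ (+ n) 0)

toℚ-+ : ∀ a b → toℚ (a ℕ.+ b) ≡ toℚ a ℚ.+ toℚ b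
toℚ-+ a b = ℚ.toℚᵘ-injective (ℚᵘ.≃-trans (toℚᵘ-toℚ (a ℕ.+ b)) (ℚᵘ.≃-trans
  (*≡* (cong (ℤ._* + 1) (trans (ℤ.pos-+ a b)
    (sym (cong₂ ℤ._+_ (ℤ.*-identityʳ (+ a)) (ℤ.*-identityʳ (+ b)))))))
  (ℚᵘ.≃-sym (ℚᵘ.≃-trans (ℚ.toℚᵘ-homo-+ (toℚ a) (toℚ b))
    (ℚᵘ.+-cong (toℚᵘ-toℚ a) (toℚᵘ-toℚ b))))))

toℚ-* : ∀ a b → toℚ (a ℕ.* b) ≡ toℚ a * toℚ b
toℚ-* a b = ℚ.toℚᵘ-injective (ℚᵘ.≃-trans (toℚᵘ-toℚ (a ℕ.* b)) (ℚᵘ.≃-trans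
  (*≡* (cong (ℤ._* + 1) (ℤ.pos-* a b)))
  (ℚᵘ.≃-sym (ℚᵘ.≃-trans (ℚ.toℚᵘ-homo-* (toℚ a) (toℚ b))
    (ℚᵘ.*-cong (toℚᵘ-toℚ a) (toℚᵘ-toℚ b))))))

toℚ-cancel-≤ : ∀ {a b} → toℚ a ≤ toℚ b → a ℕ.≤ b
toℚ-cancel-≤ {a} {b} le
  with ℚᵘ.≤-respʳ-≃ (toℚᵘ-toℚ b) (ℚᵘ.≤-respˡ-≃ (toℚᵘ-toℚ a) (ℚ.toℚᵘ-mono-≤ le))
... | *≤* le′ = ℤ.drop‿+≤+ (subst₂ ℤ._≤_ (ℤ.*-identityʳ (+ a)) (ℤ.*-identityʳ (+ b)) le′)

toℚ-nonNeg : ∀ n → ℚ.NonNegative (toℚ n)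
toℚ-nonNeg n = ℚ.normalize-nonNeg n 1

toℚ-↧ₙ-* : ∀ r → 0ℚ ≤ r → toℚ (↧ₙ r) * r ≡ toℚ ℤ.∣ ↥ r ∣
toℚ-↧ₙ-* r@(mkℚ (+ a) d _) _ = ℚ.toℚᵘ-injective
  (ℚᵘ.≃-trans (ℚ.toℚᵘ-homo-* (toℚ (suc d)) r) (ℚᵘ.≃-trans (ℚᵘ.*-congʳ (toℚᵘ-toℚ (suc d)))
    (ℚᵘ.≃-trans (*≡* cross) (ℚᵘ.≃-sym (toℚᵘ-toℚ a)))))
  where
  cross : (+ suc d ℤ.* + a) ℤ.* + 1 ≡ + a ℤ.* + (1 ℕ.* suc d)
  cross = trans (ℤ.*-identityʳ _) (trans (ℤ.*-comm (+ suc d) (+ a))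
            (cong (λ k → + a ℤ.* + k) (sym (ℕ.*-identityˡ (suc d)))))
toℚ-↧ₙ-* (mkℚ -[1+ _ ] _ _) (ℚ.*≤* ())

numeratorOver : ℕ → ℚ → ℕ
numeratorOver D r = D ℕ./ ↧ₙ r ℕ.* ℤ.∣ ↥ r ∣

toℚ-numeratorOver : ∀ D r → ↧ₙ r ∣ D → 0ℚ ≤ r → toℚ D * r ≡ toℚ (numeratorOver D r)
toℚ-numeratorOver D r ↧r∣D 0≤r = begin
  toℚ D * r                           ≡⟨ cong (λ n → toℚ n * r) (sym (m/n*n≡m ↧r∣D)) ⟩
  toℚ (k ℕ.* ↧ₙ r) * r                ≡⟨ cong (_* r) (toℚ-* k (↧ₙ r)) ⟩
  toℚ k * toℚ (↧ₙ r) * r              ≡⟨ ℚ.*-assoc (toℚ k) (toℚ (↧ₙ r)) r ⟩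
  toℚ k * (toℚ (↧ₙ r) * r)            ≡⟨ cong (toℚ k *_) (toℚ-↧ₙ-* r 0≤r) ⟩
  toℚ k * toℚ ℤ.∣ ↥ r ∣               ≡⟨ sym (toℚ-* k ℤ.∣ ↥ r ∣) ⟩
  toℚ (numeratorOver D r)             ∎
  where
  open ≡-Reasoning
  k = D ℕ./ ↧ₙ r

commonDenominator : List ℚ → ℕ
commonDenominator rs = product (map ↧ₙ_ rs)

↧ₙ-∣-commonDenominator : ∀ rs {r} → r ∈ rs → ↧ₙ r ∣ commonDenominator rs
↧ₙ-∣-commonDenominator rs r∈rs = ∈⇒∣product (∈-map⁺ ↧ₙ_ r∈rs)

commonDenominator≥1 : ∀ rs → commonDenominator rs ≥ 1
commonDenominator≥1 rs = ℕ.>-nonZero⁻¹ _ {{product≢0 (All.map⁺ (All.universal (λ _ → _) rs))}}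

module _ {A : Set} where

  sum-map-mono-≤ : ∀ {f g : A → ℕ} → (∀ a → f a ℕ.≤ g a) → ∀ l →
                   sumℕ (map f l) ℕ.≤ sumℕ (map g l)
  sum-map-mono-≤ f≤g []      = ℕ.z≤n
  sum-map-mono-≤ f≤g (a ∷ l) = ℕ.+-mono-≤ (f≤g a) (sum-map-mono-≤ f≤g l)

  sumℚ-map-zero : ∀ {f : A → ℚ} → (∀ a → f a ≡ 0ℚ) → ∀ l → sumℚ (map f l) ≡ 0ℚ
  sumℚ-map-zero f≡0 []      = refl
  sumℚ-map-zero f≡0 (a ∷ l) = cong₂ ℚ._+_ (f≡0 a) (sumℚ-map-zero f≡0 l)

  toℚ-sum-map : ∀ c {f : A → ℕ} {g : A → ℚ} {l} → All (λ a → toℚ (f a) ≡ c * g a) l →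
                toℚ (sumℕ (map f l)) ≡ c * sumℚ (map g l)
  toℚ-sum-map c {l = []}              All.[]       = sym (ℚ.*-zeroʳ c)
  toℚ-sum-map c {f} {g} {l = a ∷ l} (fa≡ All.∷ l≡) = begin
    toℚ (f a ℕ.+ sumℕ (map f l))          ≡⟨ toℚ-+ (f a) _ ⟩
    toℚ (f a) ℚ.+ toℚ (sumℕ (map f l))    ≡⟨ cong₂ ℚ._+_ fa≡ (toℚ-sum-map c l≡) ⟩
    c * g a ℚ.+ c * sumℚ (map g l)        ≡⟨ ℚ.*-distribˡ-+ c (g a) _ ⟨
    c * sumℚ (map g (a ∷ l))              ∎
    where open ≡-Reasoning

  sum-map-*-indicator : ∀ (m : A → ℕ) (b : A → Bool) l →
    sumℕ (map (λ a → m a ℕ.* (if b a then 1 else 0)) l) ≡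
    sumℕ (map m (filter (λ a → b a Bool.≟ true) l))
  sum-map-*-indicator m b [] = refl
  sum-map-*-indicator m b (a ∷ l) with b a
  ... | true  = cong₂ ℕ._+_ (ℕ.*-identityʳ (m a)) (sum-map-*-indicator m b l)
  ... | false rewrite ℕ.*-zeroʳ (m a) = sum-map-*-indicator m b l

  replicateEach : (A → ℕ) → List A → List A
  replicateEach m = concatMap (λ a → replicate (m a) a)

  length-replicateEach : ∀ (m : A → ℕ) l → length (replicateEach m l) ≡ sumℕ (map m l)
  length-replicateEach m []      = refl
  length-replicateEach m (a ∷ l) = trans (List.length-++ (replicate (m a) a))
    (cong₂ ℕ._+_ (List.length-replicate (m a)) (length-replicateEach m l))

  sum-map-replicate : ∀ (f : A → ℕ) k a → sumℕ (map f (replicate k a)) ≡ k ℕ.* f a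
  sum-map-replicate f zero    a = refl
  sum-map-replicate f (suc k) a = cong (f a ℕ.+_) (sum-map-replicate f k a)

  sum-map-replicateEach : ∀ (f m : A → ℕ) l →
    sumℕ (map f (replicateEach m l)) ≡ sumℕ (map (λ a → m a ℕ.* f a) l)
  sum-map-replicateEach f m []      = refl
  sum-map-replicateEach f m (a ∷ l) = begin
    sumℕ (map f (replicate (m a) a ++ replicateEach m l))
      ≡⟨ cong sumℕ (List.map-++ f (replicate (m a) a) _) ⟩
    sumℕ (map f (replicate (m a) a) ++ map f (replicateEach m l))
      ≡⟨ sum-++ (map f (replicate (m a) a)) _ ⟩
    sumℕ (map f (replicate (m a) a)) ℕ.+ sumℕ (map f (replicateEach m l))
      ≡⟨ cong₂ ℕ._+_ (sum-map-replicate f (m a) a) (sum-map-replicateEach f m l) ⟩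
    m a ℕ.* f a ℕ.+ sumℕ (map (λ a → m a ℕ.* f a) l) ∎
    where open ≡-Reasoning

  all-replicateEach : ∀ {P : A → Set} (m : A → ℕ) {l} → All P l → All P (replicateEach m l)
  all-replicateEach m = All.concat⁺ ∘ All.map⁺ ∘ All.map (All.replicate⁺ (m _))

Σℕ-suc : ∀ q (f : Fin (suc q) → ℕ) → Σℕ (suc q) f ≡ f Fin.zero ℕ.+ Σℕ q (f ∘ Fin.suc)
Σℕ-suc q f = cong (λ fs → f Fin.zero ℕ.+ sumℕ fs)
  (trans (List.map-tabulate Fin.suc f) (sym (List.map-tabulate id (f ∘ Fin.suc))))

Σℕ-mono-≤ : ∀ t {f g : Fin t → ℕ} → (∀ i → f i ℕ.≤ g i) → Σℕ t f ℕ.≤ Σℕ t g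
Σℕ-mono-≤ t f≤g = sum-map-mono-≤ f≤g (allFin t)

Σℕ-inject≤-≤ : ∀ {q m} (f : Fin m → ℕ) (q≤m : q ℕ.≤ m) →
               Σℕ q (λ k → f (inject≤ k q≤m)) ℕ.≤ Σℕ m f
Σℕ-inject≤-≤ {zero}  f q≤m = ℕ.z≤n
Σℕ-inject≤-≤ {suc q} {suc m} f (ℕ.s≤s q≤m) = begin
  Σℕ (suc q) (λ k → f (inject≤ k (ℕ.s≤s q≤m)))                ≡⟨ Σℕ-suc q _ ⟩
  f Fin.zero ℕ.+ Σℕ q (λ k → f (Fin.suc (inject≤ k q≤m)))
    ≤⟨ ℕ.+-monoʳ-≤ (f Fin.zero) (Σℕ-inject≤-≤ (f ∘ Fin.suc) q≤m) ⟩
  f Fin.zero ℕ.+ Σℕ m (f ∘ Fin.suc)                           ≡⟨ Σℕ-suc m f ⟨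
  Σℕ (suc m) f                                                ∎
  where open ℕ.≤-Reasoning

Σℕ-lookup : ∀ {A : Set} (g : A → ℕ) l → Σℕ (length l) (g ∘ lookup l) ≡ sumℕ (map g l)
Σℕ-lookup g l = cong sumℕ (begin
  map (g ∘ lookup l) (allFin (length l))   ≡⟨ List.map-∘ (allFin (length l)) ⟩
  map g (map (lookup l) (allFin _))        ≡⟨ cong (map g) (List.map-tabulate id (lookup l)) ⟩
  map g (tabulate (lookup l))              ≡⟨ cong (map g) (List.tabulate-lookup l) ⟩
  map g l                                  ∎)
  where open ≡-Reasoning

toℚ-Σℕ : ∀ t c {f : Fin t → ℕ} {g : Fin t → ℚ} → (∀ i → toℚ (f i) ≡ c * g i) →
         toℚ (Σℕ t f) ≡ c * Σℚ t g
toℚ-Σℕ t c f≡cg = toℚ-sum-map c (All.universal f≡cg (allFin t))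

through : (H : Graph) → V H → List (List (V H)) → List (List (V H))
through H w = filter (λ p → memB H w p Bool.≟ true)

if-then-0-≤ : ∀ (b : Bool) {a c} → a ℕ.≤ c → (if b then a else 0) ℕ.≤ c
if-then-0-≤ true  a≤c = a≤c
if-then-0-≤ false _   = ℕ.z≤n

module IntegralScaling (H : Graph) {t : ℕ} (W : Fin t → V H)
  {x : List (V H) → ℚ} {ε : ℚ} (feasible : Feasible H W x ε)
  (D : ℕ) (m : List (V H) → ℕ) (m≡D*x : All (λ p → toℚ (m p) ≡ toℚ D * x p) (allLists H))
  (q : ℕ) (D*ε≡q : toℚ D * ε ≡ toℚ q) where

  pathsBetween : Fin t → Fin t → List (List (V H))
  pathsBetween i j = paths H (W i) (W j)

  pool : Fin t → Fin t → List (List (V H))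
  pool i j = replicateEach m (pathsBetween i j)

  visits : V H → Fin t → Fin t → ℕ
  visits w i j = sumℕ (map m (through H w (pathsBetween i j)))

  demand : ∀ i j → ε ≤ sumℚ (map x (pathsBetween i j))
  demand = proj₁ (proj₂ feasible)

  capacity : ∀ w → Σℚ t (λ i → Σℚ t (λ j → sumℚ (map x (through H w (pathsBetween i j))))) ≤ 1ℚ
  capacity = proj₂ (proj₂ feasible)

  m≡D*x-between : ∀ i j → All (λ p → toℚ (m p) ≡ toℚ D * x p) (pathsBetween i j)
  m≡D*x-between i j = All.filter⁺ (λ p → isPathB H (W i) (W j) p Bool.≟ true) m≡D*x

  q≤length-pool : ∀ i j → q ℕ.≤ length (pool i j)
  q≤length-pool i j = toℚ-cancel-≤ (begin
    toℚ q
      ≡⟨ D*ε≡q ⟨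
    toℚ D * ε
      ≤⟨ ℚ.*-monoˡ-≤-nonNeg (toℚ D) {{toℚ-nonNeg D}} (demand i j) ⟩
    toℚ D * sumℚ (map x (pathsBetween i j))
      ≡⟨ toℚ-sum-map (toℚ D) (m≡D*x-between i j) ⟨
    toℚ (sumℕ (map m (pathsBetween i j)))
      ≡⟨ cong toℚ (length-replicateEach m (pathsBetween i j)) ⟨
    toℚ (length (pool i j)) ∎)
    where open ℚ.≤-Reasoning

  linkage : Fin t → Fin t → Fin q → List (V H)
  linkage i j k = lookup (pool i j) (inject≤ k (q≤length-pool i j))

  isLinkage : IsLinkage H W q linkage
  isLinkage i j _ k = All.lookup (all-replicateEach m all-paths) (∈-lookup _)
    where
    all-paths : All (IsPath H (W i) (W j)) (pathsBetween i j)
    all-paths = All.all-filter (λ p → isPathB H (W i) (W j) p Bool.≟ true) (allLists H)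

  pair-load≤visits : ∀ w i j →
    Σℕ q (λ k → if memB H w (linkage i j k) then 1 else 0) ℕ.≤ visits w i j
  pair-load≤visits w i j = begin
    Σℕ q (λ k → indicator (lookup (pool i j) (inject≤ k _)))
      ≤⟨ Σℕ-inject≤-≤ (indicator ∘ lookup (pool i j)) (q≤length-pool i j) ⟩
    Σℕ (length (pool i j)) (indicator ∘ lookup (pool i j))
      ≡⟨ Σℕ-lookup indicator (pool i j) ⟩
    sumℕ (map indicator (pool i j))
      ≡⟨ sum-map-replicateEach indicator m (pathsBetween i j) ⟩
    sumℕ (map (λ p → m p ℕ.* indicator p) (pathsBetween i j))
      ≡⟨ sum-map-*-indicator m (memB H w) (pathsBetween i j) ⟩
    visits w i j ∎
    where
    open ℕ.≤-Reasoning
    indicator : List (V H) → ℕ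
    indicator p = if memB H w p then 1 else 0

  total-visits≤D : ∀ w → Σℕ t (λ i → Σℕ t (visits w i)) ℕ.≤ D
  total-visits≤D w = toℚ-cancel-≤ (begin
    toℚ (Σℕ t (λ i → Σℕ t (visits w i)))
      ≡⟨ toℚ-Σℕ t (toℚ D) (λ i → toℚ-Σℕ t (toℚ D) (λ j →
           toℚ-sum-map (toℚ D) (All.filter⁺ (λ p → memB H w p Bool.≟ true) (m≡D*x-between i j)))) ⟩
    toℚ D * Σℚ t (λ i → Σℚ t (λ j → sumℚ (map x (through H w (pathsBetween i j)))))
      ≤⟨ ℚ.*-monoˡ-≤-nonNeg (toℚ D) {{toℚ-nonNeg D}} (capacity w) ⟩
    toℚ D * 1ℚ
      ≡⟨ ℚ.*-identityʳ (toℚ D) ⟩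
    toℚ D ∎)
    where open ℚ.≤-Reasoning

  congested : Congested H W D q linkage
  congested w = ℕ.≤-trans
    (Σℕ-mono-≤ t λ i → Σℕ-mono-≤ t λ j → if-then-0-≤ ⌊ i Fin.<? j ⌋ (pair-load≤visits w i j))
    (total-visits≤D w)

zero-feasible : ∀ (H : Graph) {t} (W : Fin t → V H) → Feasible H W (λ _ → 0ℚ) 0ℚ
zero-feasible H {t} W = (λ _ → ℚ.≤-refl) , demand , capacity
  where
  demand : ∀ i j → 0ℚ ≤ sumℚ (map (λ _ → 0ℚ) (paths H (W i) (W j)))
  demand i j = ℚ.≤-reflexive (sym (sumℚ-map-zero (λ _ → refl) (paths H (W i) (W j))))
  capacity : ∀ w →
    Σℚ t (λ i → Σℚ t (λ j → sumℚ (map (λ _ → 0ℚ) (through H w (paths H (W i) (W j)))))) ≤ 1ℚ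
  capacity w = ℚ.≤-trans
    (ℚ.≤-reflexive (sumℚ-map-zero (λ i → sumℚ-map-zero (λ j →
      sumℚ-map-zero (λ _ → refl) (through H w (paths H (W i) (W j)))) (allFin t)) (allFin t)))
    (ℚ.*≤* (ℤ.+≤+ ℕ.z≤n))

lemma34 : (H : Graph) (t : ℕ) (W : Fin t → Fin (n H)) → Injective _≡_ _≡_ W →
    (ε : ℚ) → IsEps H W ε →
    ∃ λ (D : ℕ) → D ≥ 1 × Σ ℕ λ q → (((+ D) / 1) * ε ≡ (+ q) / 1) ×
      Σ (Fin t → Fin t → Fin q → List (Fin (n H))) λ P →
        IsLinkage H W q P × Congested H W D q P
lemma34 H t W _ ε ((x , feasible) , optimal) =
  D , commonDenominator≥1 rs , numeratorOver D ε , D*ε≡q , linkage , isLinkage , congested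
  where
  rs : List ℚ
  rs = ε ∷ map x (allLists H)
  D : ℕ
  D = commonDenominator rs
  D*ε≡q : toℚ D * ε ≡ toℚ (numeratorOver D ε)
  D*ε≡q = toℚ-numeratorOver D ε (↧ₙ-∣-commonDenominator rs (here refl))
            (optimal (λ _ → 0ℚ) 0ℚ (zero-feasible H W))
  m≡D*x : All (λ p → toℚ (numeratorOver D (x p)) ≡ toℚ D * x p) (allLists H)
  m≡D*x = All.tabulate λ {p} p∈ →
    sym (toℚ-numeratorOver D (x p) (↧ₙ-∣-commonDenominator rs (there (∈-map⁺ x p∈)))
                           (proj₁ feasible p))
  open IntegralScaling H W feasible D (numeratorOver D ∘ x) m≡D*x (numeratorOver D ε) D*ε≡q
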